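{- Let $d \geq 1$, $r \geq 2$ and $k > 2r(d-1)$ be integers with $k > d$. Then there exists a constant $C$ (independent of $n$) such that for all $n > k$, $$ f(n,k,d,r) \leq n\,\frac{k-2r(d-1)}{r\bigl(k-(r+1)(d-1)\bigr)} + C. $$ In particular, $f(n,k,d,2) \leq \frac{k-4d+4}{2(k-3d+3)}\,n + C$.
   Context: All graphs are finite, simple and undirected. For a graph $G$ and positive integers $d,r$, $f_G(d,r)$ denotes the largest integer $t$ such that in every coloring of the edges of $G$ with $r$ colors there is a monochromatic subgraph (a subgraph all of whose edges have the same color) with minimum degree at least $d$ and order (number of vertices) at least $t$. For $n > k > d$, $f(n,k,d,r)$ denotes the minimum of $f_G(d,r)$ over all graphs $G$ with $n$ vertices and minimum degree at least $k$. -}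

module Defs where

open import Data.Nat using (ℕ; _≤_; _<_)
open import Data.Fin using (Fin; _≟_)
open import Data.Fin.Subset using (Subset; _∈_; _∩_; ∣_∣)
open import Data.Bool using (Bool; true; false; _∧_)
open import Data.Vec using (tabulate)
open import Data.Product using (Σ; ∃; ∃-syntax; _×_)
open import Relation.Nullary.Decidable using (⌊_⌋)
open import Relation.Binary.PropositionalEquality using (_≡_)

record Graph (n : ℕ) : Set where
  field
    adj    : Fin n → Fin n → Bool
    sym    : ∀ u v → adj u v ≡ adj v u
    irrefl : ∀ u → adj u u ≡ false
open Graph public

nbhd : ∀ {n} → Graph n → Fin n → Subset n
nbhd G u = tabulate (adj G u)

degree : ∀ {n} → Graph n → Fin n → ℕ
degree G u = ∣ nbhd G u ∣

MinDegreeAtLeast : ∀ {n} → Graph n → ℕ → Set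
MinDegreeAtLeast G k = ∀ u → k ≤ degree G u

record Colouring {n : ℕ} (G : Graph n) (r : ℕ) : Set where
  field
    col    : Fin n → Fin n → Fin r
    colSym : ∀ u v → adj G u v ≡ true → col u v ≡ col v u
open Colouring public

colNbhd : ∀ {n r} {G : Graph n} → Colouring G r → Fin r → Fin n → Subset n
colNbhd {G = G} χ c u = tabulate (λ v → adj G u v ∧ ⌊ col χ u v ≟ c ⌋)

MonoMinDeg : ∀ {n r} {G : Graph n} → Colouring G r → Fin r → Subset n → ℕ → Set
MonoMinDeg χ c S d = ∀ u → u ∈ S → d ≤ ∣ colNbhd χ c u ∩ S ∣

HasMono : ∀ {n r} {G : Graph n} → Colouring G r → ℕ → ℕ → Set
HasMono {n} {r} χ d t = ∃[ c ] ∃[ S ] (MonoMinDeg χ c S d × t ≤ ∣ S ∣)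

GoodFor : ∀ {n} → Graph n → ℕ → ℕ → ℕ → Set
GoodFor G d r t = (χ : Colouring G r) → HasMono χ d t

-- t = f_G(d,r): the largest t with GoodFor G d r t
IsFG : ∀ {n} → Graph n → ℕ → ℕ → ℕ → Set
IsFG G d r t = GoodFor G d r t × (∀ t' → GoodFor G d r t' → t' ≤ t)

-- t = f(n,k,d,r): the minimum of f_G(d,r) over graphs G on n vertices
-- with minimum degree ≥ k.
IsF : ℕ → ℕ → ℕ → ℕ → ℕ → Set
IsF n k d r t =
  (Σ (Graph n) λ G → MinDegreeAtLeast G k × IsFG G d r t)
  × (∀ (G : Graph n) → MinDegreeAtLeast G k → ∀ s → IsFG G d r s → t ≤ s)

-- Write a = d - 1, D = k - 2ra and L = (r - 1)a. The graph consists of r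
-- disjoint cliques of Dq vertices and the ra-th power of a path on qrL
-- vertices, whose edges of length l get colour (l - 1)/a. The path is cut into
-- blocks of L vertices, each completely joined to D vertices of a single
-- clique i, where every colour other than i is used on a consecutive path
-- vertices of the block. Then every vertex has degree at least k (O(1) padding
-- vertices repair the ends of the path), while in colour c a vertex of another
-- clique has at most a neighbours, and the leftmost path vertex of a vertex set
-- S has at most a neighbours in S. Hence a monochromatic subgraph of minimum
-- degree d = a + 1 lies in clique c up to O(1) vertices, and n = qr(D + L) + O(1)
-- gives f ≤ Dq + O(1) = nD/(r(D + L)) + O(1).
module Submission where

open import Defs hiding (sym)
open import Data.Bool using (Bool; true; false; if_then_else_; _∧_)
open import Data.Bool.Properties using (T-≡)
open import Data.Empty using (⊥-elim)
open import Data.Fin using (Fin; toℕ) renaming (zero to fzero; suc to fsuc)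
open import Data.Fin.Properties using (toℕ<n; toℕ-fromℕ<)
open import Data.Fin.Subset using (Subset; _∈_; _∉_; _∩_; ∣_∣) renaming (⊥ to ∅)
open import Data.Fin.Subset.Properties using (∣p∣≤n; ∉⊥; x∈p∩q⁻)
open import Data.Nat
open import Data.Nat.DivMod
open import Data.Nat.Properties
open import Data.Nat.Tactic.RingSolver using (solve-∀)
open import Data.Product using (Σ; ∃-syntax; _×_; _,_; proj₁; proj₂)
open import Data.Sum using (_⊎_; inj₁; inj₂)
open import Data.Vec using ([]; _∷_; tabulate; here; there)
open import Data.Vec.Properties using (lookup∘tabulate; []=⇒lookup)
open import Function using (_∘_; Equivalence)
open import Relation.Binary.Definitions using (tri<; tri≈; tri>)
open import Relation.Binary.PropositionalEquality
open import Relation.Nullary using (¬_; yes; no)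
open import Relation.Nullary.Decidable using (toWitness)

module Counting where

  count : ℕ → (ℕ → Bool) → ℕ
  count zero    g = 0
  count (suc n) g = (if g 0 then 1 else 0) + count n (g ∘ suc)

  ∣tabulate∣≡count : ∀ n (g : ℕ → Bool) → ∣ tabulate {n = n} (g ∘ toℕ) ∣ ≡ count n g
  ∣tabulate∣≡count zero    g = refl
  ∣tabulate∣≡count (suc n) g with g 0
  ... | true  = cong suc (∣tabulate∣≡count n (g ∘ suc))
  ... | false = ∣tabulate∣≡count n (g ∘ suc)

  count-+ : ∀ m n g → count (m + n) g ≡ count m g + count n (g ∘ (m +_))
  count-+ zero    n g = refl
  count-+ (suc m) n g =
    trans (cong (b +_) (count-+ m n (g ∘ suc))) (sym (+-assoc b _ _))
    where b = if g 0 then 1 else 0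

  count-window : ∀ n g lo len → lo + len ≤ n → count len (g ∘ (lo +_)) ≤ count n g
  count-window n g lo len lo+len≤n = begin
    count len (g ∘ (lo +_))                    ≤⟨ m≤n+m _ (count lo g) ⟩
    count lo g + count len (g ∘ (lo +_))       ≡⟨ count-+ lo len g ⟨
    count (lo + len) g                         ≤⟨ m≤m+n _ _ ⟩
    count (lo + len) g + count (n ∸ (lo + len)) (g ∘ (lo + len +_)) ≡⟨ count-+ (lo + len) _ g ⟨
    count (lo + len + (n ∸ (lo + len))) g      ≡⟨ cong (λ m → count m g) (m+[n∸m]≡n lo+len≤n) ⟩
    count n g                                  ∎
    where open ≤-Reasoning

  count-windows : ∀ n g lo₁ len₁ lo₂ len₂ → lo₁ + len₁ ≤ lo₂ → lo₂ + len₂ ≤ n →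
    count len₁ (g ∘ (lo₁ +_)) + count len₂ (g ∘ (lo₂ +_)) ≤ count n g
  count-windows n g lo₁ len₁ lo₂ len₂ fst≤lo₂ snd≤n = begin
    count len₁ (g ∘ (lo₁ +_)) + count len₂ (g ∘ (lo₂ +_))
      ≤⟨ +-monoˡ-≤ _ (count-window lo₂ g lo₁ len₁ fst≤lo₂) ⟩
    count lo₂ g + count len₂ (g ∘ (lo₂ +_))  ≡⟨ count-+ lo₂ len₂ g ⟨
    count (lo₂ + len₂) g                     ≤⟨ count-window n g 0 (lo₂ + len₂) snd≤n ⟩
    count n g                                ∎
    where open ≤-Reasoning

  count-all : ∀ len g → (∀ x → x < len → g x ≡ true) → len ≤ count len g
  count-all zero      g all = z≤n
  count-all (suc len) g all rewrite all 0 z<s =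
    s≤s (count-all len (g ∘ suc) (λ x x<len → all (suc x) (s<s x<len)))

  count-all-but-one : ∀ len g p → (∀ x → x < len → x ≢ p → g x ≡ true) →
                      len ≤ suc (count len g)
  count-all-but-one zero      g p all = z≤n
  count-all-but-one (suc len) g zero all =
    s≤s (≤-trans (count-all len (g ∘ suc) (λ x x<len → all (suc x) (s<s x<len) λ ()))
                 (m≤n+m _ _))
  count-all-but-one (suc len) g (suc p) all rewrite all 0 z<s (λ ()) =
    s≤s (count-all-but-one len (g ∘ suc) p
          (λ x x<len x≢p → all (suc x) (s<s x<len) (x≢p ∘ suc-injective)))

  window⇒∣p∣≤len : ∀ {n} (p : Subset n) lo len →
    (∀ v → v ∈ p → lo ≤ toℕ v × toℕ v < lo + len) → ∣ p ∣ ≤ len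
  window⇒∣p∣≤len []          lo len inside = z≤n
  window⇒∣p∣≤len (true ∷ p)  lo len inside with inside fzero here
  ... | z≤n , _ with len
  ...   | suc len′ = s≤s (window⇒∣p∣≤len p 0 len′
                           (λ v v∈p → z≤n , ≤-pred (proj₂ (inside (fsuc v) (there v∈p)))))
  window⇒∣p∣≤len (false ∷ p) lo len inside =
    window⇒∣p∣≤len p (lo ∸ 1) len (λ v v∈p → shift lo (inside (fsuc v) (there v∈p)))
    where
    shift : ∀ {x} lo → lo ≤ suc x × suc x < lo + len → lo ∸ 1 ≤ x × x < lo ∸ 1 + len
    shift zero     (_ , x<len)     = z≤n , <-trans (n<1+n _) x<len
    shift (suc lo) (lo≤x , x<end)  = ≤-pred lo≤x , ≤-pred x<end

  ∈tabulate⁻ : ∀ {n} {f : Fin n → Bool} {v} → v ∈ tabulate f → f v ≡ true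
  ∈tabulate⁻ {f = f} {v} v∈ = trans (sym (lookup∘tabulate f v)) ([]=⇒lookup v∈)

-- Division by 0 (junk values m ÷ 0 = 0, m %% 0 = m) only occurs when the path
-- of the construction below is empty, i.e. for d = 1.
module TotalDivision where

  open import Data.Nat.Divisibility using (n∣m*n)

  infixl 7 _÷_ _%%_

  _÷_ : ℕ → ℕ → ℕ
  m ÷ zero  = 0
  m ÷ suc n = m / suc n

  _%%_ : ℕ → ℕ → ℕ
  m %% zero  = m
  m %% suc n = m % suc n

  m≡m%%n+[m÷n]*n : ∀ m n .{{_ : NonZero n}} → m ≡ m %% n + m ÷ n * n
  m≡m%%n+[m÷n]*n m (suc n) = m≡m%n+[m/n]*n m (suc n)

  m%%n<n : ∀ m n .{{_ : NonZero n}} → m %% n < n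
  m%%n<n m (suc n) = m%n<n m (suc n)

  m÷n*n≤m : ∀ m n .{{_ : NonZero n}} → m ÷ n * n ≤ m
  m÷n*n≤m m (suc n) = m/n*n≤m m (suc n)

  m<m÷n*n+n : ∀ m n .{{_ : NonZero n}} → m < m ÷ n * n + n
  m<m÷n*n+n m n = begin-strict
    m                      ≡⟨ m≡m%%n+[m÷n]*n m n ⟩
    m %% n + m ÷ n * n     <⟨ +-monoˡ-< _ (m%%n<n m n) ⟩
    n + m ÷ n * n          ≡⟨ +-comm n _ ⟩
    m ÷ n * n + n          ∎
    where open ≤-Reasoning

  ÷-unique : ∀ m n b .{{_ : NonZero n}} → b * n ≤ m → m < b * n + n → m ÷ n ≡ b
  ÷-unique m (suc n) b lo hi = begin
    m / suc n                                  ≡⟨ cong (_/ suc n) (m∸n+n≡m lo) ⟨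
    (m ∸ b * suc n + b * suc n) / suc n        ≡⟨ +-distrib-/-∣ʳ (m ∸ b * suc n) (n∣m*n b) ⟩
    (m ∸ b * suc n) / suc n + b * suc n / suc n ≡⟨ cong₂ _+_ (m<n⇒m/n≡0 rest<n) (m*n/n≡m b (suc n)) ⟩
    b                                          ∎
    where
    open ≡-Reasoning
    rest<n : m ∸ b * suc n < suc n
    rest<n = subst (m ∸ b * suc n <_) (m+n∸m≡n (b * suc n) (suc n)) (∸-monoˡ-< hi lo)

  ÷-window : ∀ lo n b y .{{_ : NonZero n}} → lo + b * n ≤ y → y < lo + b * n + n →
             (y ∸ lo) ÷ n ≡ b
  ÷-window lo n b y from≤y y<end = ÷-unique (y ∸ lo) n b
    (m+n≤o⇒m≤o∸n (b * n) (subst (_≤ y) (+-comm lo (b * n)) from≤y))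
    (subst (y ∸ lo <_) (trans (cong (_∸ lo) (+-assoc lo (b * n) n)) (m+n∸m≡n lo (b * n + n)))
           (∸-monoˡ-< y<end (m+n≤o⇒m≤o lo from≤y)))

  ÷-mono-< : ∀ m n b .{{_ : NonZero n}} → m < b * n → m ÷ n < b
  ÷-mono-< m (suc n) b = m<n*o⇒m/o<n

  ≤÷ : ∀ m n b .{{_ : NonZero n}} → b * n ≤ m → b ≤ m ÷ n
  ≤÷ m (suc n) b b*n≤m = subst (_≤ m / suc n) (m*n/n≡m b (suc n)) (/-monoˡ-≤ (suc n) b*n≤m)

  ÷-÷ : ∀ m n o .{{_ : NonZero n}} .{{_ : NonZero o}} → m ÷ n ÷ o ≡ m ÷ (n * o)
  ÷-÷ m (suc n) (suc o) = m/n/o≡m/[n*o] m (suc n) (suc o)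

module BoolReflection where

  open import Relation.Nullary.Decidable using (dec-true; dec-false)

  <ᵇ-true : ∀ {m n} → m < n → (m <ᵇ n) ≡ true
  <ᵇ-true = dec-true (_ <? _)

  <ᵇ-false : ∀ {m n} → n ≤ m → (m <ᵇ n) ≡ false
  <ᵇ-false n≤m = dec-false (_ <? _) (≤⇒≯ n≤m)

  ≤ᵇ-true : ∀ {m n} → m ≤ n → (m ≤ᵇ n) ≡ true
  ≤ᵇ-true = dec-true (_ ≤? _)

  ≤ᵇ-false : ∀ {m n} → m ≰ n → (m ≤ᵇ n) ≡ false
  ≤ᵇ-false = dec-false (_ ≤? _)

  ≡ᵇ-true : ∀ {m n} → m ≡ n → (m ≡ᵇ n) ≡ true
  ≡ᵇ-true = dec-true (_ ≟ _)

  <ᵇ-sound : ∀ {m n} → (m <ᵇ n) ≡ true → m < n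
  <ᵇ-sound {m} {n} eq = <ᵇ⇒< m n (Equivalence.from T-≡ eq)

  ≤ᵇ-sound : ∀ {m n} → (m ≤ᵇ n) ≡ true → m ≤ n
  ≤ᵇ-sound {m} {n} eq = ≤ᵇ⇒≤ m n (Equivalence.from T-≡ eq)

  ≡ᵇ-sound : ∀ {m n} → (m ≡ᵇ n) ≡ true → m ≡ n
  ≡ᵇ-sound {m} {n} eq = ≡ᵇ⇒≡ m n (Equivalence.from T-≡ eq)

  ∧-true : ∀ {b₁ b₂} → (b₁ ∧ b₂) ≡ true → b₁ ≡ true × b₂ ≡ true
  ∧-true {true} {true} _ = refl , refl

goodFor-0 : ∀ {n} (G : Graph n) d r .{{_ : NonZero r}} → GoodFor G d r 0
goodFor-0 G d (suc r) χ = fzero , ∅ , (λ u u∈∅ → ⊥-elim (∉⊥ u∈∅)) , z≤n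

goodFor⇒≤n : ∀ {n} (G : Graph n) d r t .{{_ : NonZero r}} → GoodFor G d r t → t ≤ n
goodFor⇒≤n G d (suc r) t good with good (record { col = λ _ _ → fzero ; colSym = λ _ _ _ → refl })
... | _ , S , _ , t≤∣S∣ = ≤-trans t≤∣S∣ (∣p∣≤n S)

IsF⇒≤n : ∀ {n k d r t} .{{_ : NonZero r}} → IsF n k d r t → t ≤ n
IsF⇒≤n {d = d} {r} {t} ((G , _ , good , _) , _) = goodFor⇒≤n G d r t good

¬¬-maximum : ∀ (P : ℕ → Set) bound → P 0 → (∀ m → P m → m ≤ bound) →
             ¬ ¬ (Σ ℕ λ s → P s × (∀ t → P t → t ≤ s))
¬¬-maximum P zero    P0 bounded ¬max = ¬max (0 , P0 , bounded)
¬¬-maximum P (suc b) P0 bounded ¬max = excludedMiddle λ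
  { (inj₁ P[1+b])  → ¬max (suc b , P[1+b] , bounded)
  ; (inj₂ ¬P[1+b]) → ¬¬-maximum P b P0 (λ m Pm → below m Pm ¬P[1+b]) ¬max
  }
  where
  excludedMiddle : ¬ ¬ (P (suc b) ⊎ ¬ P (suc b))
  excludedMiddle ¬lem = ¬lem (inj₂ (¬lem ∘ inj₁))
  below : ∀ m → P m → ¬ P (suc b) → m ≤ b
  below m Pm ¬P[1+b] with m ≟ suc b
  ... | yes refl = ⊥-elim (¬P[1+b] Pm)
  ... | no  m≢1+b = s≤s⁻¹ (≤∧≢⇒< (bounded m Pm) m≢1+b)

-- f_G(d, r) need not exist constructively, but only its double negation is
-- used: the conclusion t ≤ B is decidable.
IsF-bound : ∀ {n k d r t} .{{_ : NonZero r}} (G : Graph n) → MinDegreeAtLeast G k → IsF n k d r t →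
            ∀ B → (∀ s → GoodFor G d r s → s ≤ B) → t ≤ B
IsF-bound {d = d} {r} {t} G minDeg isF B bounded with t ≤? B
... | yes t≤B = t≤B
... | no  t≰B = ⊥-elim (¬¬-maximum (GoodFor G d r) B (goodFor-0 G d r) bounded
                          λ (s , good , maximal) → t≰B (≤-trans (proj₂ isF G minDeg s (good , maximal))
                                                               (bounded s good)))

-- Vertices are ℕ's below N: the path [0, nY), padding [nY, nYE) that belongs
-- to clique 0, and clique i at [nYE + iM, nYE + (i+1)M). Path vertex x lies
-- in block x ÷ L, joined to [nYE + (x ÷ L)D, +D) in colour pathColour x. The
-- first band path vertices each get k private padding neighbours in colour 1,
-- the last ones share k padding neighbours in colour 0. edge and edgeColour
-- describe a pair x < y; adjℕ and colourℕ symmetrise them.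
module Construction (r₁ a D q e : ℕ) .{{_ : NonZero D}} .{{_ : NonZero q}} where

  open Counting
  open TotalDivision
  open BoolReflection

  r band L nY nYE M k N : ℕ
  r    = suc r₁
  band = r * a
  L    = r₁ * a
  nY   = q * r * L
  nYE  = nY + e
  M    = D * q
  k    = D + (band + band)
  N    = nYE + r * M

  instance
    M≢0 : NonZero M
    M≢0 = m*n≢0 D q

    k≢0 : NonZero k
    k≢0 = >-nonZero (<-≤-trans (>-nonZero⁻¹ D) (m≤m+n D _))

  skip : ℕ → ℕ → ℕ
  skip i j = if j <ᵇ i then j else suc j

  block slot pathColour cliqueBlock clique : ℕ → ℕ
  block x       = x ÷ L
  slot x        = x %% L ÷ a
  pathColour x  = skip (block x ÷ q) (slot x)
  cliqueBlock w = (w ∸ nYE) ÷ D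
  clique w      = if w <ᵇ nYE then 0 else (w ∸ nYE) ÷ M

  inWindow : ℕ → ℕ → ℕ → Bool
  inWindow lo len y = (lo ≤ᵇ y) ∧ (y <ᵇ lo + len)

  padEdge : ℕ → ℕ → Bool
  padEdge x y = if x <ᵇ band then inWindow (nY + x * k) k y
                else if nY ≤ᵇ x + band then inWindow (nY + band * k) k y
                else false

  edge : ℕ → ℕ → Bool
  edge x y = if y <ᵇ nY then y ∸ x ≤ᵇ band
             else if x <ᵇ nY then (if y <ᵇ nYE then padEdge x y else cliqueBlock y ≡ᵇ block x)
             else clique x ≡ᵇ clique y

  edgeColour : ℕ → ℕ → ℕ
  edgeColour x y = if y <ᵇ nY then (y ∸ x ∸ 1) ÷ a
                   else if x <ᵇ nY then (if y <ᵇ nYE then (if x <ᵇ band then 1 else 0) else pathColour x)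
                   else clique x

  adjℕ : ℕ → ℕ → Bool
  adjℕ x y = (x ⊓ y <ᵇ x ⊔ y) ∧ edge (x ⊓ y) (x ⊔ y)

  colourℕ : ℕ → ℕ → ℕ
  colourℕ x y = edgeColour (x ⊓ y) (x ⊔ y)

  adjℕ-sym : ∀ x y → adjℕ x y ≡ adjℕ y x
  adjℕ-sym x y rewrite ⊓-comm x y | ⊔-comm x y = refl

  adjℕ-irrefl : ∀ x → adjℕ x x ≡ false
  adjℕ-irrefl x rewrite ⊓-idem x | ⊔-idem x | <ᵇ-false (≤-refl {x}) = refl

  colourℕ-sym : ∀ x y → colourℕ x y ≡ colourℕ y x
  colourℕ-sym x y rewrite ⊓-comm x y | ⊔-comm x y = refl

  adjℕ⇒≢ : ∀ {x y} → adjℕ x y ≡ true → x ≢ y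
  adjℕ⇒≢ {x} adj refl with trans (sym adj) (adjℕ-irrefl x)
  ... | ()

  adjℕ-< : ∀ {x y} → x < y → adjℕ x y ≡ edge x y
  adjℕ-< {x} {y} x<y rewrite m≤n⇒m⊓n≡m (<⇒≤ x<y) | m≤n⇒m⊔n≡n (<⇒≤ x<y) | <ᵇ-true x<y = refl

  adjℕ-> : ∀ {x y} → y < x → adjℕ x y ≡ edge y x
  adjℕ-> {x} {y} y<x = trans (adjℕ-sym x y) (adjℕ-< y<x)

  colourℕ-< : ∀ {x y} → x < y → colourℕ x y ≡ edgeColour x y
  colourℕ-< {x} {y} x<y rewrite m≤n⇒m⊓n≡m (<⇒≤ x<y) | m≤n⇒m⊔n≡n (<⇒≤ x<y) = refl

  colourℕ-> : ∀ {x y} → y < x → colourℕ x y ≡ edgeColour y x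
  colourℕ-> {x} {y} y<x = trans (colourℕ-sym x y) (colourℕ-< y<x)

  nY≤nYE : nY ≤ nYE
  nY≤nYE = m≤m+n nY e

  nYE≤N : nYE ≤ N
  nYE≤N = m≤m+n nYE (r * M)

  L≢0 : ∀ {x} → x < nY → NonZero L
  L≢0 x<nY = m*n≢0⇒n≢0 (q * r) {{>-nonZero (≤-<-trans z≤n x<nY)}}

  a≢0 : ∀ {x} → x < nY → NonZero a
  a≢0 x<nY = m*n≢0⇒n≢0 r₁ {{L≢0 x<nY}}

  r₁≢0 : ∀ {x} → x < nY → NonZero r₁
  r₁≢0 x<nY = m*n≢0⇒m≢0 r₁ {{L≢0 x<nY}}

  block<qr : ∀ {x} → x < nY → block x < q * r
  block<qr {x} x<nY = ÷-mono-< x L (q * r) {{L≢0 x<nY}} x<nY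

  blockWindow-fits : ∀ {b} → b < q * r → nYE + b * D + D ≤ N
  blockWindow-fits {b} b<qr = begin
    nYE + b * D + D    ≡⟨ +-assoc nYE _ D ⟩
    nYE + (b * D + D)  ≡⟨ cong (nYE +_) (+-comm (b * D) D) ⟩
    nYE + suc b * D    ≤⟨ +-monoʳ-≤ nYE (*-monoˡ-≤ D b<qr) ⟩
    nYE + q * r * D    ≡⟨ cong (nYE +_) (qrD≡rM q r D) ⟩
    N                  ∎
    where
    open ≤-Reasoning
    qrD≡rM : ∀ q r D → q * r * D ≡ r * (D * q)
    qrD≡rM = solve-∀

  inWindow-true : ∀ lo len z → z < len → inWindow lo len (lo + z) ≡ true
  inWindow-true lo len z z<len rewrite ≤ᵇ-true (m≤m+n lo z) | <ᵇ-true (+-monoʳ-< lo z<len) = refl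

  cliqueBlock-window : ∀ b z → z < D → cliqueBlock (nYE + b * D + z) ≡ b
  cliqueBlock-window b z z<D = ÷-window nYE D b _ (m≤m+n _ z) (+-monoʳ-< (nYE + b * D) z<D)

  -- Adjacency and degrees

  adj-path : ∀ {x y} → x < y → y < nY → y ∸ x ≤ band → adjℕ x y ≡ true
  adj-path x<y y<nY close rewrite adjℕ-< x<y | <ᵇ-true y<nY | ≤ᵇ-true close = refl

  adj-pad : ∀ {x y} → x < nY → nY ≤ y → y < nYE → padEdge x y ≡ true → adjℕ x y ≡ true
  adj-pad x<nY nY≤y y<nYE pad
    rewrite adjℕ-< (<-≤-trans x<nY nY≤y) | <ᵇ-false nY≤y | <ᵇ-true x<nY | <ᵇ-true y<nYE = pad

  adj-block : ∀ {x y} → x < nY → nYE ≤ y → cliqueBlock y ≡ block x → adjℕ x y ≡ true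
  adj-block x<nY nYE≤y same
    rewrite adjℕ-< (<-≤-trans x<nY (≤-trans nY≤nYE nYE≤y)) | <ᵇ-false (≤-trans nY≤nYE nYE≤y)
          | <ᵇ-true x<nY | <ᵇ-false nYE≤y | ≡ᵇ-true same = refl

  adj-clique : ∀ {x y} → nY ≤ x → nY ≤ y → x ≢ y → clique x ≡ clique y → adjℕ x y ≡ true
  adj-clique {x} {y} nY≤x nY≤y x≢y same with <-cmp x y
  ... | tri< x<y _ _ rewrite adjℕ-< x<y | <ᵇ-false (≤-trans nY≤x (<⇒≤ x<y)) | <ᵇ-false nY≤x
                            | ≡ᵇ-true same = refl
  ... | tri≈ _ x≡y _ = ⊥-elim (x≢y x≡y)
  ... | tri> _ _ y<x rewrite adjℕ-> y<x | <ᵇ-false (≤-trans nY≤y (<⇒≤ y<x)) | <ᵇ-false nY≤y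
                            | ≡ᵇ-true (sym same) = refl

  clique-≥nYE : ∀ {w} → nYE ≤ w → clique w ≡ (w ∸ nYE) ÷ M
  clique-≥nYE nYE≤w rewrite <ᵇ-false nYE≤w = refl

  clique-window : ∀ i {y} → nYE + i * M ≤ y → y < nYE + i * M + M → clique y ≡ i
  clique-window i from≤y y<end =
    trans (clique-≥nYE (m+n≤o⇒m≤o nYE from≤y)) (÷-window nYE M i _ from≤y y<end)

  clique-first : ∀ {y} → y < nYE + M → clique y ≡ 0
  clique-first {y} y<end with y <? nYE
  ... | yes y<nYE rewrite <ᵇ-true y<nYE = refl
  ... | no  y≮nYE = clique-window 0 (subst (_≤ y) (sym (+-identityʳ nYE)) (≮⇒≥ y≮nYE))
                                    (subst (λ s → y < s + M) (sym (+-identityʳ nYE)) y<end)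

  clique-bounds : ∀ {w} → nYE ≤ w → nYE + clique w * M ≤ w × w < nYE + clique w * M + M
  clique-bounds {w} nYE≤w rewrite clique-≥nYE nYE≤w = from≤w , w<end
    where
    i = (w ∸ nYE) ÷ M
    from≤w : nYE + i * M ≤ w
    from≤w = subst (nYE + i * M ≤_) (m+[n∸m]≡n nYE≤w) (+-monoʳ-≤ nYE (m÷n*n≤m (w ∸ nYE) M))
    w<end : w < nYE + i * M + M
    w<end = subst₂ _<_ (m+[n∸m]≡n nYE≤w) (sym (+-assoc nYE (i * M) M))
                   (+-monoʳ-< nYE (m<m÷n*n+n (w ∸ nYE) M))

  clique<r : ∀ {w} → w < N → clique w < r
  clique<r {w} w<N with w <? nYE
  ... | yes w<nYE rewrite <ᵇ-true w<nYE = z<s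
  ... | no  w≮nYE rewrite <ᵇ-false (≮⇒≥ w≮nYE) =
    ÷-mono-< (w ∸ nYE) M r (subst (w ∸ nYE <_) (m+n∸m≡n nYE (r * M)) (∸-monoˡ-< w<N (≮⇒≥ w≮nYE)))

  padEdge-own : ∀ {x} z → x < band → z < k → padEdge x (nY + x * k + z) ≡ true
  padEdge-own {x} z x<band z<k rewrite <ᵇ-true x<band = inWindow-true (nY + x * k) k z z<k

  padEdge-end : ∀ {x} z → band ≤ x → nY ≤ x + band → z < k → padEdge x (nY + band * k + z) ≡ true
  padEdge-end z band≤x end z<k rewrite <ᵇ-false band≤x | ≤ᵇ-true end =
    inWindow-true (nY + band * k) k z z<k

  adj-near : ∀ lo z → lo + band + band < nY → z ≤ band + band → z ≢ band →
             adjℕ (lo + band) (lo + z) ≡ true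
  adj-near lo z inner z≤2band z≢band with <-cmp z band
  ... | tri< z<band _ _ = trans (adjℕ-sym (lo + band) (lo + z))
          (adj-path (+-monoʳ-< lo z<band) (≤-<-trans (m≤m+n _ band) inner)
                    (subst (_≤ band) (sym ([m+n]∸[m+o]≡n∸o lo band z)) (m∸n≤m band z)))
  ... | tri≈ _ z≡band _ = ⊥-elim (z≢band z≡band)
  ... | tri> _ _ band<z = adj-path (+-monoʳ-< lo band<z)
          (≤-<-trans (subst (lo + z ≤_) (sym (+-assoc lo band band)) (+-monoʳ-≤ lo z≤2band)) inner)
          (subst (_≤ band) (sym ([m+n]∸[m+o]≡n∸o lo z band)) (m≤n+o⇒m∸n≤o z band z≤2band))

  degree-window : ∀ {x} lo len → lo + len ≤ N → (∀ z → z < len → adjℕ x (lo + z) ≡ true) →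
                  len ≤ count N (adjℕ x)
  degree-window lo len fits all = ≤-trans (count-all len _ all) (count-window N _ lo len fits)

  degree-inner : ∀ lo → lo + band + band < nY → k ≤ count N (adjℕ (lo + band))
  degree-inner lo inner = begin
    D + (band + band)                                      ≡⟨ +-comm D _ ⟩
    band + band + D                                        ≤⟨ +-mono-≤ nearCount blockCount ⟩
    count (suc (band + band)) (adjℕ x ∘ (lo +_)) + count D (adjℕ x ∘ (blockStart +_))
                                                           ≤⟨ count-windows N _ lo _ blockStart D near≤blockStart
                                                                (blockWindow-fits (block<qr x<nY)) ⟩
    count N (adjℕ x)                                       ∎
    where
    open ≤-Reasoning
    x = lo + band
    blockStart = nYE + block x * D
    x<nY : x < nY
    x<nY = ≤-<-trans (m≤m+n x band) inner
    nearCount : band + band ≤ count (suc (band + band)) (adjℕ x ∘ (lo +_))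
    nearCount = s≤s⁻¹ (count-all-but-one _ _ band
                        (λ z z<len z≢band → adj-near lo z inner (s≤s⁻¹ z<len) z≢band))
    blockCount : D ≤ count D (adjℕ x ∘ (blockStart +_))
    blockCount = count-all D _ (λ z z<D →
      adj-block x<nY (≤-trans (m≤m+n nYE _) (m≤m+n blockStart z)) (cliqueBlock-window (block x) z z<D))
    near≤blockStart : lo + suc (band + band) ≤ blockStart
    near≤blockStart = begin
      lo + suc (band + band)  ≡⟨ +-suc lo _ ⟩
      suc (lo + (band + band)) ≡⟨ cong suc (+-assoc lo band band) ⟨
      suc (x + band)          ≤⟨ inner ⟩
      nY                      ≤⟨ nY≤nYE ⟩
      nYE                     ≤⟨ m≤m+n nYE _ ⟩
      blockStart              ∎

  degree-clique-window : ∀ {w} lo len → lo ≤ w → w < lo + len → lo + len ≤ N → nY ≤ lo →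
    (∀ z → z < len → clique (lo + z) ≡ clique w) → len ≤ suc (count N (adjℕ w))
  degree-clique-window {w} lo len lo≤w w<end fits nY≤lo same =
    ≤-trans (count-all-but-one len (adjℕ w ∘ (lo +_)) (w ∸ lo) near)
            (s≤s (count-window N _ lo len fits))
    where
    near : ∀ z → z < len → z ≢ w ∸ lo → adjℕ w (lo + z) ≡ true
    near z z<len z≢ = adj-clique (≤-trans nY≤lo lo≤w) (≤-trans nY≤lo (m≤m+n lo z))
      (λ w≡ → z≢ (trans (sym (m+n∸m≡n lo z)) (cong (_∸ lo) (sym w≡))))
      (sym (same z z<len))

  module _ (k<M : k < M) (pads-fit : band * k + k ≤ e) where

    endPad-fits : nY + band * k + k ≤ nYE
    endPad-fits = subst (_≤ nYE) (sym (+-assoc nY _ k)) (+-monoʳ-≤ nY pads-fit)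

    ownPad-fits : ∀ {x} → x < band → nY + x * k + k ≤ nYE
    ownPad-fits {x} x<band = begin
      nY + x * k + k     ≡⟨ +-assoc nY _ k ⟩
      nY + (x * k + k)   ≡⟨ cong (nY +_) (+-comm (x * k) k) ⟩
      nY + suc x * k     ≤⟨ +-monoʳ-≤ nY (*-monoˡ-≤ k x<band) ⟩
      nY + band * k      ≤⟨ m≤m+n _ k ⟩
      nY + band * k + k  ≤⟨ endPad-fits ⟩
      nYE                ∎
      where open ≤-Reasoning

    degree-pad : ∀ {x} lo → x < nY → nY + lo + k ≤ nYE → (∀ z → z < k → padEdge x (nY + lo + z) ≡ true) →
                 k ≤ count N (adjℕ x)
    degree-pad lo x<nY fits pad = degree-window (nY + lo) k (≤-trans fits nYE≤N) (λ z z<k →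
      adj-pad x<nY (≤-trans (m≤m+n nY lo) (m≤m+n _ z)) (<-≤-trans (+-monoʳ-< (nY + lo) z<k) fits)
              (pad z z<k))

    degree-path : ∀ {x} → x < nY → k ≤ count N (adjℕ x)
    degree-path {x} x<nY with x <? band | nY ≤? x + band
    ... | yes x<band | _ =
      degree-pad (x * k) x<nY (ownPad-fits x<band) (λ z → padEdge-own z x<band)
    ... | no x≮band | yes end =
      degree-pad (band * k) x<nY endPad-fits (λ z → padEdge-end z (≮⇒≥ x≮band) end)
    ... | no x≮band | no inner = subst (λ y → k ≤ count N (adjℕ y)) (m∸n+n≡m (≮⇒≥ x≮band))
      (degree-inner (x ∸ band)
        (subst (λ y → y + band < nY) (sym (m∸n+n≡m (≮⇒≥ x≮band))) (≰⇒> inner)))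

    degree-clique : ∀ {w} → nY ≤ w → w < N → k ≤ count N (adjℕ w)
    degree-clique {w} nY≤w w<N with w <? nYE + M
    ... | yes w<firstEnd = s≤s⁻¹ (≤-trans (<-≤-trans k<M (m≤n+m M e))
      (degree-clique-window nY (e + M) nY≤w (subst (w <_) (+-assoc nY e M) w<firstEnd)
        (subst (_≤ N) (+-assoc nY e M) (+-monoʳ-≤ nYE (m≤m+n M _))) ≤-refl
        (λ z z<len → trans (clique-first (subst (nY + z <_) (sym (+-assoc nY e M))
                                                (+-monoʳ-< nY z<len)))
                           (sym (clique-first w<firstEnd)))))
    ... | no w≮firstEnd = s≤s⁻¹ (≤-trans k<M
      (degree-clique-window (nYE + i * M) M from≤w w<end fits (≤-trans nY≤nYE (m≤m+n nYE _))
        (λ z z<M → clique-window i (m≤m+n _ z) (+-monoʳ-< _ z<M))))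
      where
      nYE≤w = ≤-trans (m≤m+n nYE M) (≮⇒≥ w≮firstEnd)
      i = clique w
      from≤w = proj₁ (clique-bounds nYE≤w)
      w<end = proj₂ (clique-bounds nYE≤w)
      fits : nYE + i * M + M ≤ N
      fits = ≤-trans (≤-reflexive (trans (+-assoc nYE _ M) (cong (nYE +_) (+-comm (i * M) M))))
                     (+-monoʳ-≤ nYE (*-monoˡ-≤ M (clique<r w<N)))

    degree≥k : ∀ {x} → x < N → k ≤ count N (adjℕ x)
    degree≥k {x} x<N with x <? nY
    ... | yes x<nY = degree-path x<nY
    ... | no  x≮nY = degree-clique (≮⇒≥ x≮nY) x<N

  -- Edge colours

  edge-path : ∀ {x y} → y < nY → edge x y ≡ true →
              y ∸ x ≤ band × edgeColour x y ≡ (y ∸ x ∸ 1) ÷ a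
  edge-path y<nY e rewrite <ᵇ-true y<nY = ≤ᵇ-sound e , refl

  edge-pad : ∀ {x y} → x < nY → nY ≤ y → y < nYE → edge x y ≡ true →
    (x < band × nY + x * k ≤ y × y < nY + x * k + k × edgeColour x y ≡ 1) ⊎
    (band ≤ x × nY ≤ x + band × edgeColour x y ≡ 0)
  edge-pad {x} x<nY nY≤y y<nYE e rewrite <ᵇ-false nY≤y | <ᵇ-true x<nY | <ᵇ-true y<nYE
    with x <? band
  ... | yes x<band rewrite <ᵇ-true x<band =
    inj₁ (x<band , ≤ᵇ-sound (proj₁ (∧-true e)) , <ᵇ-sound (proj₂ (∧-true e)) , refl)
  ... | no x≮band rewrite <ᵇ-false (≮⇒≥ x≮band) with nY ≤? x + band
  ...   | yes end = inj₂ (≮⇒≥ x≮band , end , refl)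
  ...   | no ¬end rewrite ≤ᵇ-false ¬end with e
  ...     | ()

  edge-block : ∀ {x y} → x < nY → nYE ≤ y → edge x y ≡ true →
               cliqueBlock y ≡ block x × edgeColour x y ≡ pathColour x
  edge-block x<nY nYE≤y e
    rewrite <ᵇ-false (≤-trans nY≤nYE nYE≤y) | <ᵇ-true x<nY | <ᵇ-false nYE≤y = ≡ᵇ-sound e , refl

  edge-clique : ∀ {x y} → nY ≤ x → x < y → edge x y ≡ true →
                clique x ≡ clique y × edgeColour x y ≡ clique x
  edge-clique nY≤x x<y e rewrite <ᵇ-false (≤-trans nY≤x (<⇒≤ x<y)) | <ᵇ-false nY≤x =
    ≡ᵇ-sound e , refl

  colour-clique : ∀ {w x} → nY ≤ w → nY ≤ x → adjℕ w x ≡ true → colourℕ w x ≡ clique w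
  colour-clique {w} {x} nY≤w nY≤x adj with <-cmp w x
  ... | tri< w<x _ _ = trans (colourℕ-< w<x) (proj₂ (edge-clique nY≤w w<x (trans (sym (adjℕ-< w<x)) adj)))
  ... | tri≈ _ w≡x _ = ⊥-elim (adjℕ⇒≢ adj w≡x)
  ... | tri> _ _ x<w = trans (colourℕ-> x<w) (trans (proj₂ same) (proj₁ same))
    where same = edge-clique nY≤x x<w (trans (sym (adjℕ-> x<w)) adj)

  unskip : ℕ → ℕ → ℕ
  unskip i c = if c <ᵇ i then c else c ∸ 1

  skip≢ : ∀ i j → skip i j ≢ i
  skip≢ i j with j <? i
  ... | yes j<i rewrite <ᵇ-true j<i = <⇒≢ j<i
  ... | no  j≮i rewrite <ᵇ-false (≮⇒≥ j≮i) = ≢-sym (<⇒≢ (s≤s (≮⇒≥ j≮i)))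

  unskip-skip : ∀ i j → unskip i (skip i j) ≡ j
  unskip-skip i j with j <? i
  ... | yes j<i rewrite <ᵇ-true j<i | <ᵇ-true j<i = refl
  ... | no  j≮i rewrite <ᵇ-false (≮⇒≥ j≮i) | <ᵇ-false (m≤n⇒m≤1+n (≮⇒≥ j≮i)) = refl

  skip<r : ∀ i j → j < r₁ → skip i j < r
  skip<r i j j<r₁ with j <ᵇ i
  ... | true  = m<n⇒m<1+n j<r₁
  ... | false = s≤s j<r₁

  edgeColour<r : ∀ {x y} → x < y → y < N → edge x y ≡ true → edgeColour x y < r
  edgeColour<r {x} {y} x<y y<N e with y <? nY | x <? nY
  ... | yes y<nY | _ = subst (_< r) (sym (proj₂ (edge-path y<nY e)))
    (÷-mono-< _ a r {{a≢0 y<nY}}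
      (<-≤-trans (∸-monoʳ-< z<s (m<n⇒0<n∸m x<y)) (proj₁ (edge-path y<nY e))))
  ... | no _ | no x≮nY =
    subst (_< r) (sym (proj₂ (edge-clique (≮⇒≥ x≮nY) x<y e))) (clique<r (<-trans x<y y<N))
  ... | no y≮nY | yes x<nY with y <? nYE
  ...   | yes y<nYE with edge-pad x<nY (≮⇒≥ y≮nY) y<nYE e
  ...     | inj₁ (_ , _ , _ , colour≡1) = subst (_< r) (sym colour≡1) (s≤s (>-nonZero⁻¹ r₁ {{r₁≢0 x<nY}}))
  ...     | inj₂ (_ , _ , colour≡0) = subst (_< r) (sym colour≡0) z<s
  edgeColour<r {x} {y} x<y y<N e | no y≮nY | yes x<nY | no y≮nYE =
    subst (_< r) (sym (proj₂ (edge-block x<nY (≮⇒≥ y≮nYE) e)))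
      (skip<r (block x ÷ q) (slot x) (÷-mono-< (x %% L) a r₁ {{a≢0 x<nY}} (m%%n<n x L {{L≢0 x<nY}})))

  colourℕ<r : ∀ {x y} → x < N → y < N → adjℕ x y ≡ true → colourℕ x y < r
  colourℕ<r {x} {y} x<N y<N adj with <-cmp x y
  ... | tri< x<y _ _ = subst (_< r) (sym (colourℕ-< x<y)) (edgeColour<r x<y y<N (trans (sym (adjℕ-< x<y)) adj))
  ... | tri≈ _ x≡y _ = ⊥-elim (adjℕ⇒≢ adj x≡y)
  ... | tri> _ _ y<x = subst (_< r) (sym (colourℕ-> y<x)) (edgeColour<r y<x x<N (trans (sym (adjℕ-> y<x)) adj))

  clique≡cliqueBlock÷q : ∀ {w} → nYE ≤ w → clique w ≡ cliqueBlock w ÷ q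
  clique≡cliqueBlock÷q {w} nYE≤w = trans (clique-≥nYE nYE≤w) (sym (÷-÷ (w ∸ nYE) D q))

  path-decomposition : ∀ {x} → x < nY → x ≡ block x * L + slot x * a + x %% L %% a
  path-decomposition {x} x<nY = begin
    x                                        ≡⟨ m≡m%%n+[m÷n]*n x L ⟩
    x %% L + block x * L                     ≡⟨ cong (_+ block x * L) (m≡m%%n+[m÷n]*n (x %% L) a) ⟩
    x %% L %% a + slot x * a + block x * L   ≡⟨ reorder (x %% L %% a) (slot x * a) (block x * L) ⟩
    block x * L + slot x * a + x %% L %% a   ∎
    where
    open ≡-Reasoning
    instance
      _ = L≢0 x<nY
      _ = a≢0 x<nY
    reorder : ∀ u v w → u + v + w ≡ w + v + u
    reorder = solve-∀

  cliqueNeighbour-on-path : ∀ {w x} c → nY ≤ w → clique w ≢ c → adjℕ w x ≡ true → colourℕ w x ≡ c →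
                            x < nY
  cliqueNeighbour-on-path {w} {x} c nY≤w w∉c adj colour≡c with x <? nY
  ... | yes x<nY = x<nY
  ... | no  x≮nY = ⊥-elim (w∉c (trans (sym (colour-clique nY≤w (≮⇒≥ x≮nY) adj)) colour≡c))

  pad-owner : ∀ {w x} → nY ≤ w → w < nYE → x < nY → adjℕ w x ≡ true → colourℕ w x ≢ 0 →
              x ≡ (w ∸ nY) ÷ k
  pad-owner {w} {x} nY≤w w<nYE x<nY adj colour≢0
    with edge-pad x<nY nY≤w w<nYE (trans (sym (adjℕ-> (<-≤-trans x<nY nY≤w))) adj)
  ... | inj₁ (_ , from≤w , w<to , _) = sym (÷-window nY k x w from≤w w<to)
  ... | inj₂ (_ , _ , colour≡0) = ⊥-elim (colour≢0 (trans (colourℕ-> (<-≤-trans x<nY nY≤w)) colour≡0))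

  block-position : ∀ {w x} → nYE ≤ w → x < nY → adjℕ w x ≡ true →
    x ≡ cliqueBlock w * L + unskip (clique w) (colourℕ w x) * a + x %% L %% a
  block-position {w} {x} nYE≤w x<nY adj = begin
    x                                                          ≡⟨ path-decomposition x<nY ⟩
    block x * L + slot x * a + x %% L %% a                     ≡⟨ cong₂ (λ b j → b * L + j * a + x %% L %% a)
                                                                         (sym (proj₁ facts)) slot≡ ⟩
    cliqueBlock w * L + unskip (clique w) (colourℕ w x) * a + x %% L %% a ∎
    where
    open ≡-Reasoning
    x<w = <-≤-trans x<nY (≤-trans nY≤nYE nYE≤w)
    facts = edge-block x<nY nYE≤w (trans (sym (adjℕ-> x<w)) adj)
    slot≡ : slot x ≡ unskip (clique w) (colourℕ w x)
    slot≡ = trans (sym (unskip-skip (block x ÷ q) (slot x))) (cong₂ unskip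
      (sym (trans (clique≡cliqueBlock÷q nYE≤w) (cong (_÷ q) (proj₁ facts))))
      (trans (sym (proj₂ facts)) (sym (colourℕ-> x<w))))

  offClique-window : ∀ {w} c → nY ≤ w → clique w ≢ c →
    ∃[ lo ] ∀ {x} → adjℕ w x ≡ true → colourℕ w x ≡ c → lo ≤ x × x < lo + a
  offClique-window {w} c nY≤w w∉c with w <? nYE
  ... | yes w<nYE = (w ∸ nY) ÷ k , λ {x} adj colour≡c →
    let x<nY = cliqueNeighbour-on-path c nY≤w w∉c adj colour≡c
        x≡   = pad-owner nY≤w w<nYE x<nY adj λ colour≡0 →
                 w∉c (trans (clique-first (<-≤-trans w<nYE (m≤m+n nYE M)))
                            (trans (sym colour≡0) colour≡c))
    in  ≤-reflexive (sym x≡) ,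
        subst₂ _<_ (+-identityʳ x) (cong (_+ a) x≡) (+-monoʳ-< x (>-nonZero⁻¹ a {{a≢0 x<nY}}))
  ... | no w≮nYE = cliqueBlock w * L + unskip (clique w) c * a , λ {x} adj colour≡c →
    let x<nY = cliqueNeighbour-on-path c nY≤w w∉c adj colour≡c
        x≡   = subst (λ c → x ≡ cliqueBlock w * L + unskip (clique w) c * a + x %% L %% a) colour≡c
                     (block-position (≮⇒≥ w≮nYE) x<nY adj)
    in  subst (_ ≤_) (sym x≡) (m≤m+n _ _) ,
        subst (_< _) (sym x≡) (+-monoʳ-< _ (m%%n<n (x %% L) a {{a≢0 x<nY}}))

  path-forward-window : ∀ {s x} c → s < x → x < nY → adjℕ s x ≡ true → colourℕ s x ≡ c →
                        s + c * a + 1 ≤ x × x < s + c * a + 1 + a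
  path-forward-window {s} {x} c s<x x<nY adj colour≡c = from≤x , x<to
    where
    open ≤-Reasoning
    instance _ = a≢0 x<nY
    δ = x ∸ s ∸ 1
    x≡ : s + δ + 1 ≡ x
    x≡ = trans (+-assoc s δ 1) (trans (cong (s +_) (m∸n+n≡m (m<n⇒0<n∸m s<x))) (m+[n∸m]≡n (<⇒≤ s<x)))
    δ÷a≡c : δ ÷ a ≡ c
    δ÷a≡c = trans (sym (proj₂ (edge-path x<nY (trans (sym (adjℕ-< s<x)) adj))))
                  (trans (sym (colourℕ-< s<x)) colour≡c)
    from≤x : s + c * a + 1 ≤ x
    from≤x = begin
      s + c * a + 1  ≤⟨ +-monoˡ-≤ 1 (+-monoʳ-≤ s (subst (λ j → j * a ≤ δ) δ÷a≡c (m÷n*n≤m δ a))) ⟩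
      s + δ + 1      ≡⟨ x≡ ⟩
      x              ∎
    x<to : x < s + c * a + 1 + a
    x<to = begin-strict
      x                    ≡⟨ x≡ ⟨
      s + δ + 1            <⟨ +-monoˡ-< 1 (+-monoʳ-< s
                                (subst (λ j → δ < j * a + a) δ÷a≡c (m<m÷n*n+n δ a))) ⟩
      s + (c * a + a) + 1  ≡⟨ reorder s (c * a) a ⟩
      s + c * a + 1 + a    ∎
      where
      reorder : ∀ s u v → s + (u + v) + 1 ≡ s + u + 1 + v
      reorder = solve-∀

  path-clique-colour : ∀ {s x} → s < nY → nY ≤ x → adjℕ s x ≡ true →
                       ¬ (colourℕ s x ≡ 0 × nY ≤ s + band) → colourℕ s x ≢ clique x
  path-clique-colour {s} {x} s<nY nY≤x adj notEnd with x <? nYE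
  ... | yes x<nYE with edge-pad s<nY nY≤x x<nYE (trans (sym (adjℕ-< (<-≤-trans s<nY nY≤x))) adj)
  ...   | inj₁ (_ , _ , _ , colour≡1) = λ colour≡ → 0≢1+n (begin
    0               ≡⟨ clique-first (<-≤-trans x<nYE (m≤m+n nYE M)) ⟨
    clique x        ≡⟨ colour≡ ⟨
    colourℕ s x     ≡⟨ colourℕ-< (<-≤-trans s<nY nY≤x) ⟩
    edgeColour s x  ≡⟨ colour≡1 ⟩
    1               ∎)
    where open ≡-Reasoning
  ...   | inj₂ (_ , end , colour≡0) =
    ⊥-elim (notEnd (trans (colourℕ-< (<-≤-trans s<nY nY≤x)) colour≡0 , end))
  path-clique-colour {s} {x} s<nY nY≤x adj notEnd | no x≮nYE = λ colour≡ →
    skip≢ (block s ÷ q) (slot s) (begin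
      pathColour s       ≡⟨ proj₂ facts ⟨
      edgeColour s x     ≡⟨ colourℕ-< s<x ⟨
      colourℕ s x        ≡⟨ colour≡ ⟩
      clique x           ≡⟨ clique≡cliqueBlock÷q (≮⇒≥ x≮nYE) ⟩
      cliqueBlock x ÷ q  ≡⟨ cong (_÷ q) (proj₁ facts) ⟩
      block s ÷ q        ∎)
    where
    open ≡-Reasoning
    s<x = <-≤-trans s<nY nY≤x
    facts = edge-block s<nY (≮⇒≥ x≮nYE) (trans (sym (adjℕ-< s<x)) adj)

  path-neighbours : ∀ {s x} c → s < nY → ¬ (c ≡ 0 × nY ≤ s + band) →
    adjℕ s x ≡ true → colourℕ s x ≡ c →
    x < s ⊎ (s + c * a + 1 ≤ x × x < s + c * a + 1 + a) ⊎ (nY ≤ x × clique x ≢ c)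
  path-neighbours {s} {x} c s<nY notEnd adj colour≡c with <-cmp x s | x <? nY
  ... | tri< x<s _ _ | _ = inj₁ x<s
  ... | tri≈ _ x≡s _ | _ = ⊥-elim (adjℕ⇒≢ adj (sym x≡s))
  ... | tri> _ _ s<x | yes x<nY = inj₂ (inj₁ (path-forward-window c s<x x<nY adj colour≡c))
  ... | tri> _ _ s<x | no  x≮nY = inj₂ (inj₂ (≮⇒≥ x≮nY , λ x∈c →
    path-clique-colour s<nY (≮⇒≥ x≮nY) adj
      (λ (colour≡0 , end) → notEnd (trans (sym colour≡c) colour≡0 , end)) (trans colour≡c (sym x∈c))))

  -- Monochromatic subgraphs

  graph : Graph N
  graph = record
    { adj    = λ u v → adjℕ (toℕ u) (toℕ v)
    ; sym    = λ u v → adjℕ-sym (toℕ u) (toℕ v)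
    ; irrefl = λ u → adjℕ-irrefl (toℕ u)
    }

  colouring : Colouring graph r
  colouring = record
    { col    = λ u v → colourℕ (toℕ u) (toℕ v) mod r
    ; colSym = λ u v _ → cong (_mod r) (colourℕ-sym (toℕ u) (toℕ v))
    }

  graph-minDegree : k < M → band * k + k ≤ e → MinDegreeAtLeast graph k
  graph-minDegree k<M pads-fit u = subst (k ≤_) (sym (∣tabulate∣≡count N (adjℕ (toℕ u))))
                                         (degree≥k k<M pads-fit (toℕ<n u))

  colourNeighbour : ∀ {c u v} → v ∈ colNbhd colouring c u →
                    adjℕ (toℕ u) (toℕ v) ≡ true × colourℕ (toℕ u) (toℕ v) ≡ toℕ c
  colourNeighbour {c} {u} {v} v∈ = proj₁ both , (begin
    colourℕ (toℕ u) (toℕ v)            ≡⟨ m<n⇒m%n≡m (colourℕ<r (toℕ<n u) (toℕ<n v) (proj₁ both)) ⟨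
    colourℕ (toℕ u) (toℕ v) % r        ≡⟨ toℕ-fromℕ< _ ⟨
    toℕ (colourℕ (toℕ u) (toℕ v) mod r) ≡⟨ cong toℕ (toWitness (Equivalence.from T-≡ (proj₂ both))) ⟩
    toℕ c                              ∎)
    where
    open ≡-Reasoning
    both = ∧-true (∈tabulate⁻ v∈)

  module _ {c : Fin r} {S : Subset N} (mono : MonoMinDeg colouring c S (suc a)) where

    ∉-if-window : ∀ u lo → (∀ {v} → v ∈ S → adjℕ (toℕ u) (toℕ v) ≡ true →
                    colourℕ (toℕ u) (toℕ v) ≡ toℕ c → lo ≤ toℕ v × toℕ v < lo + a) → u ∉ S
    ∉-if-window u lo window u∈S = 1+n≰n (≤-trans (mono u u∈S) (window⇒∣p∣≤len _ lo a inside))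
      where
      inside : ∀ v → v ∈ colNbhd colouring c u ∩ S → lo ≤ toℕ v × toℕ v < lo + a
      inside v v∈ with x∈p∩q⁻ (colNbhd colouring c u) S v∈
      ... | v∈nbhd , v∈S = window v∈S (proj₁ (colourNeighbour v∈nbhd)) (proj₂ (colourNeighbour v∈nbhd))

    offClique-∉ : ∀ u → nY ≤ toℕ u → clique (toℕ u) ≢ toℕ c → u ∉ S
    offClique-∉ u nY≤u u∉c with offClique-window (toℕ c) nY≤u u∉c
    ... | lo , window = ∉-if-window u lo (λ _ → window)

    -- The leftmost path vertex of S would have at most a neighbours of colour c in S.
    path-∉ : ∀ u → toℕ u < nY → ¬ (toℕ c ≡ 0 × nY ≤ toℕ u + band) → u ∉ S
    path-∉ u = below (suc (toℕ u)) u ≤-refl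
      where
      below : ∀ bound u → toℕ u < bound → toℕ u < nY → ¬ (toℕ c ≡ 0 × nY ≤ toℕ u + band) → u ∉ S
      below (suc bound) u u<bound u<nY notEnd = ∉-if-window u (toℕ u + toℕ c * a + 1) forward
        where
        forward : ∀ {v} → v ∈ S → adjℕ (toℕ u) (toℕ v) ≡ true → colourℕ (toℕ u) (toℕ v) ≡ toℕ c →
                  toℕ u + toℕ c * a + 1 ≤ toℕ v × toℕ v < toℕ u + toℕ c * a + 1 + a
        forward {v} v∈S adj colour≡c with path-neighbours (toℕ c) u<nY notEnd adj colour≡c
        ... | inj₁ v<u = ⊥-elim (below bound v (<-≤-trans v<u (s≤s⁻¹ u<bound)) (<-trans v<u u<nY)
                (λ (c≡0 , end) → notEnd (c≡0 , ≤-trans end (+-monoˡ-≤ band (<⇒≤ v<u)))) v∈S)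
        ... | inj₂ (inj₁ window) = window
        ... | inj₂ (inj₂ (nY≤v , v∉c)) = ⊥-elim (offClique-∉ v nY≤v v∉c v∈S)

    members-colour0 : toℕ c ≡ 0 → ∀ u → u ∈ S → nY ∸ band ≤ toℕ u × toℕ u < nYE + M
    members-colour0 c≡0 u u∈S with toℕ u <? nY
    ... | yes u<nY with nY ≤? toℕ u + band
    ...   | yes end = m≤n+o⇒m∸n≤o nY band (subst (nY ≤_) (+-comm _ band) end) ,
                      <-≤-trans u<nY (≤-trans nY≤nYE (m≤m+n nYE M))
    ...   | no notEnd = ⊥-elim (path-∉ u u<nY (notEnd ∘ proj₂) u∈S)
    members-colour0 c≡0 u u∈S | no u≮nY = ≤-trans (m∸n≤m nY band) (≮⇒≥ u≮nY) , u<nYE+M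
      where
      clique≡0 : clique (toℕ u) ≡ 0
      clique≡0 with clique (toℕ u) ≟ 0
      ... | yes u∈0 = u∈0
      ... | no  u∉0 = ⊥-elim (offClique-∉ u (≮⇒≥ u≮nY) (λ u∈c → u∉0 (trans u∈c c≡0)) u∈S)
      u<nYE+M : toℕ u < nYE + M
      u<nYE+M with toℕ u <? nYE
      ... | yes u<nYE = <-≤-trans u<nYE (m≤m+n nYE M)
      ... | no  u≮nYE = subst (λ s → toℕ u < s + M) (+-identityʳ nYE)
                          (subst (λ i → toℕ u < nYE + i * M + M) clique≡0
                                 (proj₂ (clique-bounds (≮⇒≥ u≮nYE))))

    members-colour≢0 : toℕ c ≢ 0 → ∀ u → u ∈ S →
                       nYE + toℕ c * M ≤ toℕ u × toℕ u < nYE + toℕ c * M + M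
    members-colour≢0 c≢0 u u∈S with toℕ u <? nY
    ... | yes u<nY = ⊥-elim (path-∉ u u<nY (c≢0 ∘ proj₁) u∈S)
    ... | no  u≮nY with clique (toℕ u) ≟ toℕ c
    ...   | no  u∉c = ⊥-elim (offClique-∉ u (≮⇒≥ u≮nY) u∉c u∈S)
    ...   | yes u∈c with toℕ u <? nYE
    ...     | yes u<nYE = ⊥-elim (c≢0 (trans (sym u∈c) (clique-first (<-≤-trans u<nYE (m≤m+n nYE M)))))
    ...     | no  u≮nYE = subst (λ i → nYE + i * M ≤ toℕ u × toℕ u < nYE + i * M + M) u∈c
                                (clique-bounds (≮⇒≥ u≮nYE))

    ∣S∣≤band+e+M : ∣ S ∣ ≤ band + e + M
    ∣S∣≤band+e+M with toℕ c ≟ 0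
    ... | yes c≡0 = window⇒∣p∣≤len S (nY ∸ band) (band + e + M) λ u u∈S →
      proj₁ (members-colour0 c≡0 u u∈S) , <-≤-trans (proj₂ (members-colour0 c≡0 u u∈S)) (begin
        nY + e + M                    ≤⟨ +-monoˡ-≤ M (+-monoˡ-≤ e (m≤n+m∸n nY band)) ⟩
        band + (nY ∸ band) + e + M    ≡⟨ reorder band (nY ∸ band) e M ⟩
        nY ∸ band + (band + e + M)    ∎)
      where
      open ≤-Reasoning
      reorder : ∀ b y e m → b + y + e + m ≡ y + (b + e + m)
      reorder = solve-∀
    ... | no  c≢0 = window⇒∣p∣≤len S (nYE + toℕ c * M) (band + e + M) λ u u∈S →
      proj₁ (members-colour≢0 c≢0 u u∈S) ,
      <-≤-trans (proj₂ (members-colour≢0 c≢0 u u∈S)) (+-monoʳ-≤ _ (m≤n+m M (band + e)))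

  goodFor-bound : ∀ s → GoodFor graph (suc a) r s → s ≤ band + e + M
  goodFor-bound s good with good colouring
  ... | c , S , mono , s≤∣S∣ = ≤-trans s≤∣S∣ (∣S∣≤band+e+M mono)

  IsF-N-bound : k < M → band * k + k ≤ e → ∀ {t} → IsF N k (suc a) r t → t ≤ band + e + M
  IsF-N-bound k<M pads-fit isF = IsF-bound graph (graph-minDegree k<M pads-fit) isF _ goodFor-bound

module Parameters (r₁ a k : ℕ) (2ra<k : 2 * suc r₁ * a < k) where

  open TotalDivision

  r D L P Emin N₀ C : ℕ
  r    = suc r₁
  D    = k ∸ 2 * r * a
  L    = r₁ * a
  P    = r * (k ∸ (r + 1) * a)
  Emin = r * a * k + k
  N₀   = suc k * P + Emin
  C    = r * a + N₀ + P

  k≡D+2ra : k ≡ D + (r * a + r * a)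
  k≡D+2ra = trans (sym (m∸n+n≡m (<⇒≤ 2ra<k))) (cong (D +_) (double r a))
    where
    double : ∀ r a → 2 * r * a ≡ r * a + r * a
    double = solve-∀

  P≡r[D+L] : P ≡ r * (D + L)
  P≡r[D+L] = cong (r *_) (begin
    k ∸ (r + 1) * a                            ≡⟨ cong (_∸ (r + 1) * a) (trans k≡D+2ra (regroup D r₁ a)) ⟩
    D + L + (r + 1) * a ∸ (r + 1) * a          ≡⟨ m+n∸n≡m (D + L) ((r + 1) * a) ⟩
    D + L                                      ∎)
    where
    open ≡-Reasoning
    regroup : ∀ D r₁ a → D + (suc r₁ * a + suc r₁ * a) ≡ D + r₁ * a + (suc r₁ + 1) * a
    regroup = solve-∀

  instance
    D≢0 : NonZero D
    D≢0 = >-nonZero (m<n⇒0<n∸m 2ra<k)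

    D+L≢0 : NonZero (D + L)
    D+L≢0 = >-nonZero (<-≤-trans (>-nonZero⁻¹ D) (m≤m+n D L))

    P≢0 : NonZero P
    P≢0 = subst NonZero (sym P≡r[D+L]) (m*n≢0 r (D + L))

  small-bound : ∀ {n t} → n < N₀ → t ≤ n → P * t ≤ n * D + C * P
  small-bound {n} {t} n<N₀ t≤n = begin
    P * t          ≤⟨ *-monoʳ-≤ P (≤-trans t≤n (<⇒≤ n<N₀)) ⟩
    P * N₀         ≡⟨ *-comm P N₀ ⟩
    N₀ * P         ≤⟨ *-monoˡ-≤ P (≤-trans (m≤n+m N₀ (r * a)) (m≤m+n _ P)) ⟩
    C * P          ≤⟨ m≤n+m _ _ ⟩
    n * D + C * P  ∎
    where open ≤-Reasoning

  module _ {n : ℕ} (N₀≤n : N₀ ≤ n) where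

    q e : ℕ
    q = (n ∸ Emin) ÷ P
    e = Emin + (n ∸ Emin) %% P

    Emin≤n : Emin ≤ n
    Emin≤n = m+n≤o⇒n≤o (suc k * P) N₀≤n

    n≡e+qP : n ≡ e + q * P
    n≡e+qP = begin
      n                                        ≡⟨ m+[n∸m]≡n Emin≤n ⟨
      Emin + (n ∸ Emin)                        ≡⟨ cong (Emin +_) (m≡m%%n+[m÷n]*n (n ∸ Emin) P) ⟩
      Emin + ((n ∸ Emin) %% P + q * P)         ≡⟨ +-assoc Emin _ _ ⟨
      e + q * P                                ∎
      where open ≡-Reasoning

    k<q : k < q
    k<q = ≤÷ (n ∸ Emin) P (suc k) (m+n≤o⇒m≤o∸n (suc k * P) N₀≤n)

    instance
      q≢0 : NonZero q
      q≢0 = >-nonZero (≤-<-trans z≤n k<q)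

    module G = Construction r₁ a D q e

    t≤ra+e+Dq : ∀ {t} → IsF n k (suc a) r t → t ≤ r * a + e + D * q
    t≤ra+e+Dq {t} isF =
      G.IsF-N-bound k<M pads-fit (subst₂ (λ n k → IsF n k (suc a) r t) n≡N k≡D+2ra isF)
      where
      k<M : G.k < D * q
      k<M = subst (_< D * q) k≡D+2ra (<-≤-trans k<q (m≤n*m q D))
      pads-fit : G.band * G.k + G.k ≤ e
      pads-fit = subst (λ k → r * a * k + k ≤ e) k≡D+2ra (m≤m+n Emin _)
      n≡N : n ≡ G.N
      n≡N = trans n≡e+qP (trans (cong (λ p → e + q * p) P≡r[D+L]) (layout e q r D L))
        where
        layout : ∀ e q r D L → e + q * (r * (D + L)) ≡ q * r * L + e + r * (D * q)
        layout = solve-∀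

    large-bound : ∀ {t} → IsF n k (suc a) r t → P * t ≤ n * D + C * P
    large-bound {t} isF = begin
      P * t                              ≤⟨ *-monoʳ-≤ P (t≤ra+e+Dq isF) ⟩
      P * (r * a + e + D * q)            ≡⟨ expand P (r * a + e) D q ⟩
      (r * a + e) * P + q * P * D        ≤⟨ +-mono-≤ (*-monoˡ-≤ P ra+e≤C) (*-monoˡ-≤ D qP≤n) ⟩
      C * P + n * D                      ≡⟨ +-comm (C * P) (n * D) ⟩
      n * D + C * P                      ∎
      where
      open ≤-Reasoning
      expand : ∀ P u D q → P * (u + D * q) ≡ u * P + q * P * D
      expand = solve-∀
      qP≤n : q * P ≤ n
      qP≤n = subst (q * P ≤_) (sym n≡e+qP) (m≤n+m (q * P) e)
      ra+e≤C : r * a + e ≤ C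
      ra+e≤C = begin
        r * a + (Emin + (n ∸ Emin) %% P)  ≤⟨ +-monoʳ-≤ (r * a) (+-monoʳ-≤ Emin (<⇒≤ (m%%n<n _ P))) ⟩
        r * a + (Emin + P)                ≤⟨ +-monoʳ-≤ (r * a) (+-monoˡ-≤ P (m≤n+m Emin (suc k * P))) ⟩
        r * a + (N₀ + P)                  ≡⟨ +-assoc (r * a) N₀ P ⟨
        C                                 ∎

theorem2 : ∀ (d r k : ℕ) → 1 ≤ d → 2 ≤ r → 2 * r * (d ∸ 1) < k → d < k →
    ∃[ C ] (∀ (n : ℕ) → k < n → ∀ (t : ℕ) → IsF n k d r t →
      r * (k ∸ (r + 1) * (d ∸ 1)) * t
        ≤ n * (k ∸ 2 * r * (d ∸ 1)) + C * (r * (k ∸ (r + 1) * (d ∸ 1))))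
theorem2 (suc a) (suc r₁) k _ _ 2ra<k _ = C , bound
  where
  open Parameters r₁ a k 2ra<k
  bound : ∀ n → k < n → ∀ t → IsF n k (suc a) r t → P * t ≤ n * D + C * P
  bound n _ t isF with n <? N₀
  ... | yes n<N₀ = small-bound n<N₀ (IsF⇒≤n isF)
  ... | no  n≮N₀ = large-bound (≮⇒≥ n≮N₀) isF
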